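{- Let $\mathcal{M}=\langle \mathbf{A},\mathbf{B},f,i\rangle$ be a FIDL-module. Then $\mathcal{F}_{\mathcal{M}}=\langle\mathcal{X}(\mathbf{A}),\mathcal{X}(\mathbf{B}),\subseteq,\subseteq,R_{\mathcal{M}},T_{\mathcal{M}}\rangle$ is a FI-frame.
   Context: A FIDL-module is a structure $\langle \mathbf{A},\mathbf{B},f,i\rangle$ where $\mathbf{A},\mathbf{B}$ are bounded distributive lattices and $f\colon A\times B\to A$, $i\colon B\times A\to A$ satisfy for all $x,y\in A$, $b,c\in B$: $f(x\vee y,b)=f(x,b)\vee f(y,b)$; $f(x,b\vee c)=f(x,b)\vee f(x,c)$; $f(0,b)=0$; $f(x,0)=0$; $i(b,x\wedge y)=i(b,x)\wedge i(b,y)$; $i(b\vee c,x)=i(b,x)\wedge i(c,x)$; $i(b,1)=1$. $\mathcal{X}(\mathbf{L})$ is the set of prime filters of $\mathbf{L}$, ordered by inclusion. For filters $G$ of $\mathbf{A}$, $H$ of $\mathbf{B}$: $f(G,H)=\{x\in A:\exists(g,h)\in G\times H,\ f(g,h)\le x\}$, $i(H,G)=\{x\in A:\exists(h,g)\in H\times G,\ g\le i(h,x)\}$. $(Q,R,P)\in R_{\mathcal{M}}\iff f(Q,R)\subseteq P$ and $(R,P,Q)\in T_{\mathcal{M}}\iff i(R,P)\subseteq Q$ (for $P,Q\in\mathcal{X}(\mathbf{A})$, $R\in\mathcal{X}(\mathbf{B})$). A FI-frame is a structure $\langle X,Y,\le_X,\le_Y,R,T\rangle$ where $\langle X,\le_X\rangle,\langle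 Y,\le_Y\rangle$ are posets, $R\subseteq X\times Y\times X$ and $T\subseteq Y\times X\times X$ satisfy: if $(x,y,z)\in R$, $\bar x\le_X x$, $\bar y\le_Y y$, $z\le_X\bar z$ then $(\bar x,\bar y,\bar z)\in R$; if $(y,x,z)\in T$, $\bar y\le_Y y$, $\bar x\le_X x$, $z\le_X\bar z$ then $(\bar y,\bar x,\bar z)\in T$. -}

module Defs where

open import Level using (Level; _⊔_; suc)
open import Data.Product using (Σ; _×_; ∃; ∃-syntax; _,_)
open import Data.Sum using (_⊎_)
open import Relation.Nullary using (¬_)
open import Relation.Unary using (Pred; _∈_; _∉_; _⊆_)
open import Relation.Binary using (Rel; IsPartialOrder)
open import Algebra.Lattice.Bundles using (DistributiveLattice)

record BoundedDistributiveLattice (c ℓ : Level) : Set (suc (c ⊔ ℓ)) where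
  field
    distributiveLattice : DistributiveLattice c ℓ
  open DistributiveLattice distributiveLattice public
  field
    𝟘 : Carrier
    𝟙 : Carrier
    ∨-identityʳ : ∀ x → (x ∨ 𝟘) ≈ x
    ∧-identityʳ : ∀ x → (x ∧ 𝟙) ≈ x

  _≤_ : Carrier → Carrier → Set ℓ
  x ≤ y = (x ∧ y) ≈ x

record IsFIDLModule {c ℓ : Level} (A B : BoundedDistributiveLattice c ℓ)
       (f : BoundedDistributiveLattice.Carrier A →
            BoundedDistributiveLattice.Carrier B →
            BoundedDistributiveLattice.Carrier A)
       (i : BoundedDistributiveLattice.Carrier B →
            BoundedDistributiveLattice.Carrier A →
            BoundedDistributiveLattice.Carrier A) : Set (c ⊔ ℓ) where
  private
    module A = BoundedDistributiveLattice A
    module B = BoundedDistributiveLattice B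
  field
    f-cong : ∀ {x x' b b'} → x A.≈ x' → b B.≈ b' → f x b A.≈ f x' b'
    i-cong : ∀ {b b' x x'} → b B.≈ b' → x A.≈ x' → i b x A.≈ i b' x'
    f-∨ˡ : ∀ x y b → f (x A.∨ y) b A.≈ (f x b A.∨ f y b)
    f-∨ʳ : ∀ x b c → f x (b B.∨ c) A.≈ (f x b A.∨ f x c)
    f-𝟘ˡ : ∀ b → f A.𝟘 b A.≈ A.𝟘
    f-𝟘ʳ : ∀ x → f x B.𝟘 A.≈ A.𝟘
    i-∧ʳ : ∀ b x y → i b (x A.∧ y) A.≈ (i b x A.∧ i b y)
    i-∨ˡ : ∀ b c x → i (b B.∨ c) x A.≈ (i b x A.∧ i c x)
    i-𝟙 : ∀ b → i b A.𝟙 A.≈ A.𝟙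

record FIDLModule (c ℓ : Level) : Set (suc (c ⊔ ℓ)) where
  field
    𝐀 : BoundedDistributiveLattice c ℓ
    𝐁 : BoundedDistributiveLattice c ℓ
  open BoundedDistributiveLattice 𝐀 using () renaming (Carrier to A)
  open BoundedDistributiveLattice 𝐁 using () renaming (Carrier to B)
  field
    f : A → B → A
    i : B → A → A
    isFIDLModule : IsFIDLModule 𝐀 𝐁 f i

module _ {c ℓ : Level} (L : BoundedDistributiveLattice c ℓ) where
  open BoundedDistributiveLattice L

  record IsFilter (F : Pred Carrier (c ⊔ ℓ)) : Set (c ⊔ ℓ) where
    field
      𝟙∈ : 𝟙 ∈ F
      up : ∀ {x y} → x ≤ y → x ∈ F → y ∈ F
      ∧-closed : ∀ {x y} → x ∈ F → y ∈ F → (x ∧ y) ∈ F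

  record IsPrimeFilter (F : Pred Carrier (c ⊔ ℓ)) : Set (c ⊔ ℓ) where
    field
      isFilter : IsFilter F
      proper : 𝟘 ∉ F
      prime : ∀ {x y} → (x ∨ y) ∈ F → x ∈ F ⊎ y ∈ F

  𝒳 : Set (suc (c ⊔ ℓ))
  𝒳 = Σ (Pred Carrier (c ⊔ ℓ)) IsPrimeFilter

  _⊑_ : 𝒳 → 𝒳 → Set (c ⊔ ℓ)
  (P , _) ⊑ (Q , _) = P ⊆ Q

  _≋_ : 𝒳 → 𝒳 → Set (c ⊔ ℓ)
  P ≋ Q = (P ⊑ Q) × (Q ⊑ P)

record IsFIFrame {x y e r : Level} (X : Set x) (Y : Set y)
       (_≈X_ : Rel X e) (_≤X_ : Rel X e) (_≈Y_ : Rel Y e) (_≤Y_ : Rel Y e)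
       (R : X → Y → X → Set r) (T : Y → X → X → Set r)
       : Set (x ⊔ y ⊔ e ⊔ r) where
  field
    X-poset : IsPartialOrder _≈X_ _≤X_
    Y-poset : IsPartialOrder _≈Y_ _≤Y_
    R-mono : ∀ {a b z a' b' z'} → R a b z → a' ≤X a → b' ≤Y b → z ≤X z' → R a' b' z'
    T-mono : ∀ {b a z b' a' z'} → T b a z → b' ≤Y b → a' ≤X a → z ≤X z' → T b' a' z'

module _ {c ℓ : Level} (M : FIDLModule c ℓ) where
  open FIDLModule M
  private
    module A = BoundedDistributiveLattice 𝐀
    module B = BoundedDistributiveLattice 𝐁

  f[_,_] : Pred A.Carrier (c ⊔ ℓ) → Pred B.Carrier (c ⊔ ℓ) → Pred A.Carrier (c ⊔ ℓ)
  f[ G , H ] x = ∃[ g ] ∃[ h ] (g ∈ G × h ∈ H × f g h A.≤ x)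

  i[_,_] : Pred B.Carrier (c ⊔ ℓ) → Pred A.Carrier (c ⊔ ℓ) → Pred A.Carrier (c ⊔ ℓ)
  i[ H , G ] x = ∃[ h ] ∃[ g ] (h ∈ H × g ∈ G × g A.≤ i h x)

  R-M : 𝒳 𝐀 → 𝒳 𝐁 → 𝒳 𝐀 → Set (c ⊔ ℓ)
  R-M (Q , _) (R , _) (P , _) = f[ Q , R ] ⊆ P

  T-M : 𝒳 𝐁 → 𝒳 𝐀 → 𝒳 𝐀 → Set (c ⊔ ℓ)
  T-M (R , _) (P , _) (Q , _) = i[ R , P ] ⊆ Q

-- Both f(G,H) and i(H,G) are monotone in each filter argument, since enlarging G or H only
-- adds candidate witnesses (g,h); the frame conditions then follow by composing inclusions.
-- No lattice or module axiom is needed.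
module Submission where

open import Defs
open import Level using (Level)
open import Data.Product using (_,_; proj₁)
open import Relation.Unary using (Pred; _⊆_; _≐_)
open import Relation.Unary.Properties using (⊆-trans; ⊆-reflexive; ⊆-antisym; ≐-refl; ≐-sym; ≐-trans)
open import Relation.Binary using (IsPartialOrder)
import Relation.Binary.Construct.On as On

⊆-isPartialOrder : ∀ {a ℓ} {A : Set a} → IsPartialOrder {A = Pred A ℓ} _≐_ _⊆_
⊆-isPartialOrder = record
  { isPreorder = record
    { isEquivalence = record { refl = ≐-refl ; sym = ≐-sym ; trans = ≐-trans }
    ; reflexive = ⊆-reflexive
    ; trans = ⊆-trans
    }
  ; antisym = ⊆-antisym
  }

⊑-isPartialOrder : ∀ {c ℓ} (L : BoundedDistributiveLattice c ℓ) →
  IsPartialOrder (_≋_ L) (_⊑_ L)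
⊑-isPartialOrder L = On.isPartialOrder proj₁ ⊆-isPartialOrder

module _ {c ℓ : Level} (M : FIDLModule c ℓ) where
  open FIDLModule M

  f[]-mono : ∀ {G G′ H H′} → G′ ⊆ G → H′ ⊆ H → f[_,_] M G′ H′ ⊆ f[_,_] M G H
  f[]-mono G′⊆G H′⊆H (g , h , g∈G′ , h∈H′ , fgh≤x) = g , h , G′⊆G g∈G′ , H′⊆H h∈H′ , fgh≤x

  i[]-mono : ∀ {H H′ G G′} → H′ ⊆ H → G′ ⊆ G → i[_,_] M H′ G′ ⊆ i[_,_] M H G
  i[]-mono H′⊆H G′⊆G (h , g , h∈H′ , g∈G′ , g≤ihx) = h , g , H′⊆H h∈H′ , G′⊆G g∈G′ , g≤ihx

  R-M-mono : ∀ {Q R P Q′ R′ P′} → R-M M Q R P →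
    _⊑_ 𝐀 Q′ Q → _⊑_ 𝐁 R′ R → _⊑_ 𝐀 P P′ → R-M M Q′ R′ P′
  R-M-mono QR⊆P Q′⊑Q R′⊑R P⊑P′ x∈fQ′R′ = P⊑P′ (QR⊆P (f[]-mono Q′⊑Q R′⊑R x∈fQ′R′))

  T-M-mono : ∀ {R P Q R′ P′ Q′} → T-M M R P Q →
    _⊑_ 𝐁 R′ R → _⊑_ 𝐀 P′ P → _⊑_ 𝐀 Q Q′ → T-M M R′ P′ Q′
  T-M-mono RP⊆Q R′⊑R P′⊑P Q⊑Q′ x∈iR′P′ = Q⊑Q′ (RP⊆Q (i[]-mono R′⊑R P′⊑P x∈iR′P′))

lemma4p9 : {c ℓ : Level} (M : FIDLModule c ℓ) →
    IsFIFrame (𝒳 (FIDLModule.𝐀 M)) (𝒳 (FIDLModule.𝐁 M))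
              (_≋_ (FIDLModule.𝐀 M)) (_⊑_ (FIDLModule.𝐀 M))
              (_≋_ (FIDLModule.𝐁 M)) (_⊑_ (FIDLModule.𝐁 M))
              (R-M M) (T-M M)
lemma4p9 M = record
  { X-poset = ⊑-isPartialOrder (FIDLModule.𝐀 M)
  ; Y-poset = ⊑-isPartialOrder (FIDLModule.𝐁 M)
  -- R-M and T-M match on their arguments, so the frames' implicit points cannot be inferred.
  ; R-mono = λ {Q R P Q′ R′ P′} → R-M-mono M {Q} {R} {P} {Q′} {R′} {P′}
  ; T-mono = λ {R P Q R′ P′ Q′} → T-M-mono M {R} {P} {Q} {R′} {P′} {Q′}
  }
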